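{- Let $\mathcal{F}$ be a nice family of graphs, let $\Delta>0$, and let $G\in\mathcal{F}$ have vertex set $V$ and maximum degree at most $\Delta$. If $R$ is a set of removable vertices of $G$, then there is a graph $G_1\in\mathcal{F}$ with vertex set $V\setminus R$ and maximum degree at most $\Delta$ such that $G^2-R$ is a subgraph of $G_1^2$.
   Context: Graphs are finite, simple and loopless. $G^2$ is the square of $G$ (edges between distinct vertices at distance at most two in $G$), and $G^2-R$ is obtained from $G^2$ by deleting the vertices of $R$. A vertex $v$ of $G$ is removable (with respect to $\Delta$) if it has at most $\Delta^{1/4}$ neighbours in $G$ and at most two of its neighbours in $G$ have degree at least $\Delta^{1/4}$. For $U,W\subseteq V(G)$, $e(U,W)$ is the number of edges $uw$ with $u\in U,w\in W$ (edges with both ends in $U\cap W$ counted twice). A family $\mathcal{F}$ is nice if it is closed under taking minors and there is a constant $\beta_{\mathcal{F}}$ such that for every $G\in\mathcal{F}$ and $B\subseteq V(G)$, the set $A$ of vertices of $V(G)\setminus B$ with at least three neighbours in $B$ satisfies $e(A,B)\le\beta_{\mathcal{F}}|B|$. -}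

module Defs where

open import Data.Nat using (ℕ; zero; suc; _+_; _*_; _^_; _≤_; _<_; _≤ᵇ_)
open import Data.Bool using (Bool; true; false; _∧_; not; if_then_else_)
open import Data.Fin using (Fin; zero; suc)
open import Data.Maybe using (Maybe; just; nothing)
open import Data.Product using (Σ; ∃; _×_; _,_)
open import Data.Sum using (_⊎_)
open import Relation.Binary.PropositionalEquality using (_≡_; _≢_)
open import Function.Definitions using (Injective)
open import Data.Fin using (_≟_)
open import Relation.Nullary.Decidable using (isYes)

record Graph : Set where
  field
    n     : ℕ
    adj   : Fin n → Fin n → Bool
    symm  : ∀ u v → adj u v ≡ adj v u
    irrfl : ∀ v → adj v v ≡ false
open Graph public

sumF : ∀ {n} → (Fin n → ℕ) → ℕ
sumF {zero}  f = 0
sumF {suc n} f = f zero + sumF (λ i → f (suc i))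

count : ∀ {n} → (Fin n → Bool) → ℕ
count p = sumF (λ i → if p i then 1 else 0)

VSet : Graph → Set
VSet G = Fin (n G) → Bool

deg : (G : Graph) → Fin (n G) → ℕ
deg G v = count (adj G v)

MaxDegLE : Graph → ℕ → Set
MaxDegLE G Δ = ∀ v → deg G v ≤ Δ

-- e(U,W): number of ordered pairs (u,w) with u∈U, w∈W, uw an edge
-- (so edges with both ends in U∩W are counted twice).
e : (G : Graph) → VSet G → VSet G → ℕ
e G U W = sumF (λ u → if U u then count (λ w → W w ∧ adj G u w) else 0)

card : (G : Graph) → VSet G → ℕ
card G B = count B

-- v is removable w.r.t. Δ: at most Δ^{1/4} neighbours (deg^4 ≤ Δ), and at
-- most two neighbours w of degree at least Δ^{1/4} (Δ ≤ deg(w)^4).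
Removable : ℕ → (G : Graph) → Fin (n G) → Set
Removable Δ G v =
  (deg G v ^ 4 ≤ Δ) ×
  (count (λ w → adj G v w ∧ (Δ ≤ᵇ deg G w ^ 4)) ≤ 2)

data ReachIn (G : Graph) (S : VSet G) : Fin (n G) → Fin (n G) → Set where
  here : ∀ {u} → ReachIn G S u u
  step : ∀ {u w v} → adj G u w ≡ true → S w ≡ true → ReachIn G S w v →
         ReachIn G S u v

ConnectedIn : (G : Graph) → VSet G → Set
ConnectedIn G S = ∀ u v → S u ≡ true → S v ≡ true → ReachIn G S u v

-- H is a minor of G: there is a model assigning to each vertex h of H a
-- branch set (the vertices x of G with φ x ≡ just h); branch sets are
-- pairwise disjoint (automatic, φ is a function), nonempty and connected,
-- and each edge of H is realised by an edge of G between the branch sets.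
branch : (G H : Graph) → (Fin (n G) → Maybe (Fin (n H))) → Fin (n H) → VSet G
branch G H φ h x with φ x
... | just h' = isYes (h ≟ h')
... | nothing = false

IsMinor : (H G : Graph) → Set
IsMinor H G =
  Σ (Fin (n G) → Maybe (Fin (n H))) λ φ →
    (∀ h → ∃ λ x → φ x ≡ just h) ×
    (∀ h → ConnectedIn G (branch G H φ h)) ×
    (∀ h h' → adj H h h' ≡ true →
       ∃ λ x → ∃ λ y → φ x ≡ just h × φ y ≡ just h' × adj G x y ≡ true)

Family : Set₁
Family = Graph → Set

MinorClosed : Family → Set
MinorClosed F = ∀ G H → F G → IsMinor H G → F H

Aset : (G : Graph) → VSet G → VSet G
Aset G B v = not (B v) ∧ (3 ≤ᵇ count (λ w → B w ∧ adj G v w))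

Nice : Family → Set
Nice F = MinorClosed F ×
  (∃ λ (β : ℕ) → ∀ G → F G → (B : VSet G) → e G (Aset G B) B ≤ β * card G B)

Sq : (G : Graph) → Fin (n G) → Fin (n G) → Set
Sq G u v = u ≢ v × (adj G u v ≡ true ⊎ ∃ λ w → adj G u w ≡ true × adj G w v ≡ true)

-- Each removed vertex v is assigned an anchor: a kept neighbour of v, of degree below Δ^{1/4}
-- if possible, or v itself if v has no kept neighbour. G₁ joins distinct kept x and y when a
-- vertex anchored at one of them is adjacent to the other. Contracting every removed vertex
-- into its anchor shows that G₁ is a minor of G, and a path x – v – y through a removed v
-- becomes a path of length at most two through the anchor of v.
-- For the degree bound, each G₁-neighbour y of a kept a is charged to a G-neighbour v of a.
-- Such v receives at most one charge, unless v is a removed vertex anchored at a; then it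
-- receives at most deg v ≤ Δ^{1/4} charges. If deg a ≤ Δ^{1/4} this gives at most
-- Δ^{1/4} · Δ^{1/4} ≤ Δ neighbours. Otherwise a is a big neighbour of v, so v has no small
-- kept neighbour and all its charges go to its other big neighbours, of which there is at
-- most one; then deg₁ a ≤ deg a ≤ Δ.

module Submission where

open import Defs
open import Data.Bool using (Bool; true; false; _∧_; _∨_; not; if_then_else_)
import Data.Bool as Bool
open import Data.Bool.Properties using (∧-conicalˡ; ∧-conicalʳ; not-injective; T-≡)
open import Data.Fin using (Fin; zero; suc; _≟_)
open import Data.Fin.Properties using (suc-injective; any?)
open import Data.Maybe using (Maybe; just; nothing)
import Data.Maybe as Maybe
open import Data.Maybe.Properties using (just-injective)
open import Data.Nat using (ℕ; zero; suc; _+_; _*_; _^_; _≤_; _<_; z≤n; s≤s; _≤?_; _≤ᵇ_)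
open import Data.Nat.Properties
  using ( ≤-refl; ≤-trans; ≤-reflexive; ≤-total; ≤-pred; <⇒≤; <⇒≱; ≮⇒≥; ≰⇒>; _<?_; ≤⇒≤ᵇ
        ; +-suc; +-mono-≤; +-monoʳ-≤; *-identityʳ; *-monoˡ-≤; ^-monoʳ-≤
        ; +-commutativeSemigroup; module ≤-Reasoning )
open import Algebra.Properties.CommutativeSemigroup +-commutativeSemigroup using (interchange)
open import Data.Product using (Σ; ∃; _×_; _,_; proj₁; proj₂)
open import Data.Sum using (_⊎_; inj₁; inj₂; swap)
open import Function using (_∘_; mk⇔; Equivalence)
open import Function.Definitions using (Injective)
open import Relation.Binary.PropositionalEquality
open import Relation.Nullary using (Dec; yes; no; ¬_; does; contradiction; ¬?; _×-dec_; _⊎-dec_)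
open import Relation.Nullary.Decidable using (dec-true; dec-false; does-⇔)

sumOver : ∀ {n} → (Fin n → Bool) → (Fin n → ℕ) → ℕ
sumOver p f = sumF (λ i → if p i then f i else 0)

sumF-mono : ∀ {n} {f g : Fin n → ℕ} → (∀ i → f i ≤ g i) → sumF f ≤ sumF g
sumF-mono {zero}  f≤g = z≤n
sumF-mono {suc n} f≤g = +-mono-≤ (f≤g zero) (sumF-mono (f≤g ∘ suc))

sumF-cong : ∀ {n} {f g : Fin n → ℕ} → (∀ i → f i ≡ g i) → sumF f ≡ sumF g
sumF-cong {zero}  f≗g = refl
sumF-cong {suc n} f≗g = cong₂ _+_ (f≗g zero) (sumF-cong (f≗g ∘ suc))

if-mono : ∀ b {x y : ℕ} → (b ≡ true → x ≤ y) → (if b then x else 0) ≤ (if b then y else 0)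
if-mono true  x≤y = x≤y refl
if-mono false _   = z≤n

sumOver-mono : ∀ {n} (p : Fin n → Bool) {f g : Fin n → ℕ} →
               (∀ i → p i ≡ true → f i ≤ g i) → sumOver p f ≤ sumOver p g
sumOver-mono p f≤g = sumF-mono (λ i → if-mono (p i) (f≤g i))

sumOver-const : ∀ {n} (p : Fin n → Bool) (c : ℕ) → sumOver p (λ _ → c) ≡ count p * c
sumOver-const {zero}  p c = refl
sumOver-const {suc n} p c with p zero
... | true  = cong (c +_) (sumOver-const (p ∘ suc) c)
... | false = sumOver-const (p ∘ suc) c

sumOver-indicator : ∀ {n} (p q : Fin n → Bool) →
                    sumOver p (λ i → if q i then 1 else 0) ≡ count (λ i → p i ∧ q i)
sumOver-indicator p q = sumF-cong (λ i → lemma (p i))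
  where
  lemma : ∀ b {c} → (if b then (if c then 1 else 0) else 0) ≡ (if b ∧ c then 1 else 0)
  lemma true  = refl
  lemma false = refl

indicator-mono : ∀ {a b : Bool} → (a ≡ true → b ≡ true) → (if a then 1 else 0) ≤ (if b then 1 else 0)
indicator-mono {false} a⇒b = z≤n
indicator-mono {true}  a⇒b rewrite a⇒b refl = ≤-refl

count-mono : ∀ {n} {p q : Fin n → Bool} → (∀ i → p i ≡ true → q i ≡ true) → count p ≤ count q
count-mono p⊆q = sumF-mono (λ i → indicator-mono (p⊆q i))

count-none : ∀ {n} (p : Fin n → Bool) → (∀ i → p i ≡ false) → count p ≡ 0
count-none {zero}  p none = refl
count-none {suc n} p none rewrite none zero = count-none (p ∘ suc) (none ∘ suc)

count-≤1 : ∀ {n} (p : Fin n → Bool) → (∀ i j → p i ≡ true → p j ≡ true → i ≡ j) → count p ≤ 1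
count-≤1 {zero}  p unique = z≤n
count-≤1 {suc n} p unique with p zero in p0
... | true  = ≤-reflexive (cong suc (count-none (p ∘ suc) others))
  where
  others : ∀ i → p (suc i) ≡ false
  others i with p (suc i) in pi
  ... | true  with () ← unique zero (suc i) p0 pi
  ... | false = refl
... | false = count-≤1 (p ∘ suc) (λ i j pi pj → suc-injective (unique (suc i) (suc j) pi pj))

count-∨ : ∀ {n} (p q : Fin n → Bool) → count (λ i → p i ∨ q i) ≤ count p + count q
count-∨ {zero}  p q = z≤n
count-∨ {suc n} p q = begin
  ind (p zero ∨ q zero) + count (λ i → p (suc i) ∨ q (suc i))
    ≤⟨ +-mono-≤ (indicator-∨ (p zero)) (count-∨ (p ∘ suc) (q ∘ suc)) ⟩
  (ind (p zero) + ind (q zero)) + (count (p ∘ suc) + count (q ∘ suc))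
    ≡⟨ interchange (ind (p zero)) (ind (q zero)) (count (p ∘ suc)) (count (q ∘ suc)) ⟩
  count p + count q ∎
  where
  open ≤-Reasoning
  ind : Bool → ℕ
  ind b = if b then 1 else 0
  indicator-∨ : ∀ a {b} → ind (a ∨ b) ≤ ind a + ind b
  indicator-∨ true  = s≤s z≤n
  indicator-∨ false = ≤-refl

count-strict : ∀ {n} {p q : Fin n → Bool} (a : Fin n) → (∀ i → q i ≡ true → p i ≡ true) →
               p a ≡ true → q a ≡ false → suc (count q) ≤ count p
count-strict {q = q} zero q⊆p pa qa rewrite pa | qa = s≤s (count-mono (q⊆p ∘ suc))
count-strict {suc n} {p} {q} (suc a) q⊆p pa qa =
  ≤-trans (≤-reflexive (sym (+-suc _ (count (q ∘ suc)))))
          (+-mono-≤ (indicator-mono (q⊆p zero)) (count-strict a (q⊆p ∘ suc) pa qa))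

count-pos : ∀ {n} {p : Fin n → Bool} (a : Fin n) → p a ≡ true → 1 ≤ count p
count-pos a pa = ≤-trans (s≤s z≤n) (count-strict a (λ _ ()) pa refl)

count-cover : ∀ {k n} (p : Fin k → Bool) (Q : Fin k → Fin n → Bool) (q : Fin n → Bool) →
              (∀ y → q y ≡ true → ∃ λ v → p v ≡ true × Q v y ≡ true) →
              count q ≤ sumOver p (λ v → count (Q v))
count-cover {zero} p Q q cover = ≤-reflexive (count-none q uncovered)
  where
  uncovered : ∀ y → q y ≡ false
  uncovered y with q y in qy
  ... | true with () , _ ← cover y qy
  ... | false = refl
count-cover {suc k} p Q q cover with p zero in p0
... | false = count-cover (p ∘ suc) (Q ∘ suc) q cover′
  where
  cover′ : ∀ y → q y ≡ true → ∃ λ v → p (suc v) ≡ true × Q (suc v) y ≡ true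
  cover′ y qy with cover y qy
  ... | zero  , p0≡true , _ with () ← trans (sym p0) p0≡true
  ... | suc v , pv , Qvy = v , pv , Qvy
... | true = begin
  count q                                      ≤⟨ count-mono split ⟩
  count (λ y → Q zero y ∨ rest y)              ≤⟨ count-∨ (Q zero) rest ⟩
  count (Q zero) + count rest                  ≤⟨ +-monoʳ-≤ (count (Q zero)) (count-cover (p ∘ suc) (Q ∘ suc) rest cover′) ⟩
  count (Q zero) + sumOver (p ∘ suc) (λ v → count (Q (suc v))) ∎
  where
  open ≤-Reasoning
  rest : _ → Bool
  rest y = q y ∧ not (Q zero y)
  split : ∀ y → q y ≡ true → (Q zero y ∨ rest y) ≡ true
  split y qy rewrite qy with Q zero y
  ... | true  = refl
  ... | false = refl
  cover′ : ∀ y → rest y ≡ true → ∃ λ v → p (suc v) ≡ true × Q (suc v) y ≡ true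
  cover′ y resty with cover y (∧-conicalˡ _ _ resty)
  ... | zero  , _ , Q0y with () ← trans (sym (not-injective (∧-conicalʳ _ _ resty))) Q0y
  ... | suc v , pv , Qvy = v , pv , Qvy

∃-upper-bound : ∀ {n} (P : ℕ → Set) (g : Fin n → ℕ) {b : ℕ} → P b → (∀ i → P (g i)) →
                ∃ λ M → P M × b ≤ M × (∀ i → g i ≤ M)
∃-upper-bound {zero} P g {b} Pb Pg = b , Pb , ≤-refl , λ ()
∃-upper-bound {suc n} P g {b} Pb Pg with ≤-total b (g zero)
... | inj₁ b≤g₀ with ∃-upper-bound P (g ∘ suc) (Pg zero) (Pg ∘ suc)
...   | M , PM , g₀≤M , bound = M , PM , ≤-trans b≤g₀ g₀≤M , λ { zero → g₀≤M ; (suc i) → bound i }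
∃-upper-bound {suc n} P g {b} Pb Pg | inj₂ g₀≤b with ∃-upper-bound P (g ∘ suc) Pb (Pg ∘ suc)
...   | M , PM , b≤M , bound = M , PM , b≤M , λ { zero → ≤-trans g₀≤b b≤M ; (suc i) → bound i }

m*m≤m^4 : ∀ m → m * m ≤ m ^ 4
m*m≤m^4 zero      = z≤n
m*m≤m^4 m@(suc _) = subst (_≤ m ^ 4) (cong (m *_) (*-identityʳ m)) (^-monoʳ-≤ m {2} {4} (s≤s (s≤s z≤n)))

sumOver-≤-fourthRoots : ∀ {n} Δ (p : Fin n → Bool) (g : Fin n → ℕ) →
                        count p ^ 4 ≤ Δ → (∀ i → g i ^ 4 ≤ Δ) → sumOver p g ≤ Δ
sumOver-≤-fourthRoots Δ p g |p|⁴≤Δ g⁴≤Δ with ∃-upper-bound (λ k → k ^ 4 ≤ Δ) g {count p} |p|⁴≤Δ g⁴≤Δ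
... | M , M⁴≤Δ , |p|≤M , g≤M = begin
  sumOver p g            ≤⟨ sumOver-mono p (λ i _ → g≤M i) ⟩
  sumOver p (λ _ → M)    ≡⟨ sumOver-const p M ⟩
  count p * M            ≤⟨ *-monoˡ-≤ M |p|≤M ⟩
  M * M                  ≤⟨ m*m≤m^4 M ⟩
  M ^ 4                  ≤⟨ M⁴≤Δ ⟩
  Δ                      ∎
  where open ≤-Reasoning

record Enumeration {n} (p : Fin n → Bool) : Set where
  field
    size        : ℕ
    embed       : Fin size → Fin n
    index       : Fin n → Maybe (Fin size)
    embed-∈     : ∀ u → p (embed u) ≡ true
    embed-onto  : ∀ {y} → p y ≡ true → ∃ λ u → embed u ≡ y
    index-embed : ∀ u → index (embed u) ≡ just u
    embed-index : ∀ {y u} → index y ≡ just u → embed u ≡ y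
    sumF-embed  : ∀ f → sumF (f ∘ embed) ≡ sumOver p f

module _ where
  open Enumeration

  private
    enumerate-keep : ∀ {n} {p : Fin (suc n) → Bool} → p zero ≡ true → Enumeration (p ∘ suc) → Enumeration p
    enumerate-keep p₀ E .size = suc (E .size)
    enumerate-keep p₀ E .embed zero = zero
    enumerate-keep p₀ E .embed (suc u) = suc (E .embed u)
    enumerate-keep p₀ E .index zero = just zero
    enumerate-keep p₀ E .index (suc y) = Maybe.map suc (E .index y)
    enumerate-keep p₀ E .embed-∈ zero = p₀
    enumerate-keep p₀ E .embed-∈ (suc u) = E .embed-∈ u
    enumerate-keep p₀ E .embed-onto {zero} _ = zero , refl
    enumerate-keep p₀ E .embed-onto {suc y} py with E .embed-onto py
    ... | u , eu = suc u , cong suc eu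
    enumerate-keep p₀ E .index-embed zero = refl
    enumerate-keep p₀ E .index-embed (suc u) = cong (Maybe.map suc) (E .index-embed u)
    enumerate-keep p₀ E .embed-index {zero} refl = refl
    enumerate-keep p₀ E .embed-index {suc y} e with E .index y in iy
    enumerate-keep p₀ E .embed-index {suc y} refl | just u = cong suc (E .embed-index iy)
    enumerate-keep p₀ E .sumF-embed f rewrite p₀ = cong (f zero +_) (E .sumF-embed (f ∘ suc))

    enumerate-skip : ∀ {n} {p : Fin (suc n) → Bool} → p zero ≡ false → Enumeration (p ∘ suc) → Enumeration p
    enumerate-skip p₀ E .size = E .size
    enumerate-skip p₀ E .embed = suc ∘ E .embed
    enumerate-skip p₀ E .index zero = nothing
    enumerate-skip p₀ E .index (suc y) = E .index y
    enumerate-skip p₀ E .embed-∈ = E .embed-∈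
    enumerate-skip p₀ E .embed-onto {zero} py with () ← trans (sym p₀) py
    enumerate-skip p₀ E .embed-onto {suc y} py with E .embed-onto py
    ... | u , eu = u , cong suc eu
    enumerate-skip p₀ E .index-embed = E .index-embed
    enumerate-skip p₀ E .embed-index {suc y} e = cong suc (E .embed-index e)
    enumerate-skip p₀ E .sumF-embed f rewrite p₀ = E .sumF-embed (f ∘ suc)

  enumerate : ∀ {n} (p : Fin n → Bool) → Enumeration p
  enumerate {zero} p .size = 0
  enumerate {zero} p .embed ()
  enumerate {zero} p .index ()
  enumerate {zero} p .embed-∈ ()
  enumerate {zero} p .embed-onto {()}
  enumerate {zero} p .index-embed ()
  enumerate {zero} p .embed-index {()}
  enumerate {zero} p .sumF-embed f = refl
  enumerate {suc n} p with p zero in p₀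
  ... | true  = enumerate-keep p₀ (enumerate (p ∘ suc))
  ... | false = enumerate-skip p₀ (enumerate (p ∘ suc))

dec-true⁻¹ : ∀ {A : Set} (a? : Dec A) → does a? ≡ true → A
dec-true⁻¹ (yes a) _ = a

witnessOr : ∀ {n} {P : Fin n → Set} → Dec (∃ P) → Fin n → Fin n
witnessOr (yes (x , _)) d = x
witnessOr (no _)        d = d

ReachIn-trans : ∀ {G S u v w} → ReachIn G S u v → ReachIn G S v w → ReachIn G S u w
ReachIn-trans here         q = q
ReachIn-trans (step a s p) q = step a s (ReachIn-trans p q)

star-connected : ∀ {G} {S : VSet G} c → S c ≡ true → (∀ x → S x ≡ true → x ≡ c ⊎ adj G x c ≡ true) →
                 ConnectedIn G S
star-connected {G} {S} c Sc star u v Su Sv = ReachIn-trans (toCentre u Su) (fromCentre v Sv)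
  where
  toCentre : ∀ x → S x ≡ true → ReachIn G S x c
  toCentre x Sx with star x Sx
  ... | inj₁ refl = here
  ... | inj₂ xc   = step xc Sc here
  fromCentre : ∀ x → S x ≡ true → ReachIn G S c x
  fromCentre x Sx with star x Sx
  ... | inj₁ refl = here
  ... | inj₂ xc   = step (trans (symm G c x) xc) Sx here

adj⇒≢ : ∀ G {x y} → adj G x y ≡ true → x ≢ y
adj⇒≢ G {x} xy refl with () ← trans (sym xy) (irrfl G x)

module Contraction (Δ : ℕ) (G : Graph) (R : VSet G) where

  V : Set
  V = Fin (n G)

  KeptNeighbour : V → V → Set
  KeptNeighbour v y = adj G v y ≡ true × R y ≡ false

  Big : V → Set
  Big y = Δ ≤ deg G y ^ 4

  keptNeighbour? : ∀ v y → Dec (KeptNeighbour v y)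
  keptNeighbour? v y = (adj G v y Bool.≟ true) ×-dec (R y Bool.≟ false)

  smallKeptNeighbour? : ∀ v y → Dec (KeptNeighbour v y × deg G y ^ 4 < Δ)
  smallKeptNeighbour? v y = keptNeighbour? v y ×-dec (deg G y ^ 4 <? Δ)

  relocate : V → V
  relocate v = witnessOr (any? (smallKeptNeighbour? v)) (witnessOr (any? (keptNeighbour? v)) v)

  relocate-spec : ∀ v → (KeptNeighbour v (relocate v) × (Big (relocate v) → ∀ y → KeptNeighbour v y → Big y))
                      ⊎ ((∀ y → ¬ KeptNeighbour v y) × relocate v ≡ v)
  relocate-spec v with any? (smallKeptNeighbour? v) | any? (keptNeighbour? v)
  ... | yes (x , vx , small) | _ = inj₁ (vx , λ big → contradiction big (<⇒≱ small))
  ... | no noSmall | yes (x , vx) = inj₁ (vx , λ _ y vy → ≮⇒≥ (λ small → noSmall (y , vy , small)))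
  ... | no _ | no none = inj₂ ((λ y vy → none (y , vy)) , refl)

  anchor : V → V
  anchor v = if R v then relocate v else v

  anchor-kept : ∀ {v} → R v ≡ false → anchor v ≡ v
  anchor-kept {v} Rv with R v
  anchor-kept refl | false = refl

  anchor-near : ∀ v → v ≡ anchor v ⊎ adj G v (anchor v) ≡ true
  anchor-near v with R v | relocate-spec v
  ... | false | _                       = inj₁ refl
  ... | true  | inj₁ ((v~a , _) , _)    = inj₂ v~a
  ... | true  | inj₂ (_ , relocate≡v)   = inj₁ (sym relocate≡v)

  anchor-kept-of-keptNeighbour : ∀ {v y} → KeptNeighbour v y → R (anchor v) ≡ false
  anchor-kept-of-keptNeighbour {v} {y} vy with R v in Rv | relocate-spec v
  ... | false | _                    = Rv
  ... | true  | inj₁ ((_ , Ra) , _)  = Ra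
  ... | true  | inj₂ (none , _)      = contradiction vy (none y)

  anchor-prefers-small : ∀ {v y} → R v ≡ true → KeptNeighbour v y → Big (anchor v) → Big y
  anchor-prefers-small {v} {y} Rv vy big with R v | relocate-spec v
  anchor-prefers-small refl vy big | true | inj₁ (_ , prefer) = prefer big _ vy
  anchor-prefers-small refl vy big | true | inj₂ (none , _)   = contradiction vy (none _)

  Joins : V → V → Set
  Joins x y = ∃ λ v → anchor v ≡ x × adj G v y ≡ true

  joins? : ∀ x y → Dec (Joins x y)
  joins? x y = any? (λ v → (anchor v ≟ x) ×-dec (adj G v y Bool.≟ true))

  Adj₁ : V → V → Set
  Adj₁ x y = x ≢ y × (Joins x y ⊎ Joins y x)

  adj₁? : ∀ x y → Dec (Adj₁ x y)
  adj₁? x y = ¬? (x ≟ y) ×-dec (joins? x y ⊎-dec joins? y x)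

  Adj₁-sym : ∀ {x y} → Adj₁ x y → Adj₁ y x
  Adj₁-sym (x≢y , j) = x≢y ∘ sym , swap j

  adj⇒Adj₁ : ∀ {x y} → R x ≡ false → adj G x y ≡ true → Adj₁ x y
  adj⇒Adj₁ Rx xy = adj⇒≢ G xy , inj₁ (_ , anchor-kept Rx , xy)

  kept : VSet G
  kept v = not (R v)

  enumKept : Enumeration kept
  enumKept = enumerate kept

  open Enumeration enumKept public using (embed; index; embed-index; index-embed)

  embed-kept : ∀ u → R (embed u) ≡ false
  embed-kept u = not-injective (Enumeration.embed-∈ enumKept u)

  embed-onto-kept : ∀ {y} → R y ≡ false → ∃ λ u → embed u ≡ y
  embed-onto-kept Ry = Enumeration.embed-onto enumKept (cong not Ry)

  embed-injective : ∀ {u u'} → embed u ≡ embed u' → u ≡ u'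
  embed-injective {u} {u'} e = just-injective (trans (sym (index-embed u)) (trans (cong index e) (index-embed u')))

  G₁ : Graph
  G₁ = record
    { n     = Enumeration.size enumKept
    ; adj   = λ u u' → does (adj₁? (embed u) (embed u'))
    ; symm  = λ u u' → does-⇔ (mk⇔ Adj₁-sym Adj₁-sym) (adj₁? _ _) (adj₁? _ _)
    ; irrfl = λ u → dec-false (adj₁? _ _) (λ (x≢x , _) → x≢x refl)
    }

  adj₁-intro : ∀ {u u'} → Adj₁ (embed u) (embed u') → adj G₁ u u' ≡ true
  adj₁-intro = dec-true (adj₁? _ _)

  adj₁-elim : ∀ {u u'} → adj G₁ u u' ≡ true → Adj₁ (embed u) (embed u')
  adj₁-elim = dec-true⁻¹ (adj₁? _ _)

  square-kept : ∀ {x y} → R x ≡ false → R y ≡ false → Sq G x y →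
                Adj₁ x y ⊎ ∃ λ z → R z ≡ false × Adj₁ x z × Adj₁ z y
  square-kept Rx Ry (x≢y , inj₁ xy) = inj₁ (adj⇒Adj₁ Rx xy)
  square-kept {x} {y} Rx Ry (x≢y , inj₂ (w , xw , wy)) with R w in Rw
  ... | false = inj₂ (w , Rw , adj⇒Adj₁ Rx xw , adj⇒Adj₁ Rw wy)
  ... | true with anchor w ≟ x | anchor w ≟ y
  ...   | yes refl | _        = inj₁ (x≢y , inj₁ (w , refl , wy))
  ...   | no _     | yes refl = inj₁ (x≢y , inj₂ (w , refl , trans (symm G w x) xw))
  ...   | no z≢x   | no z≢y   =
    inj₂ (anchor w , Rz , (z≢x ∘ sym , inj₂ (w , refl , w~x)) , (z≢y , inj₁ (w , refl , wy)))
    where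
    w~x = trans (symm G w x) xw
    Rz  = anchor-kept-of-keptNeighbour (w~x , Rx)

  square-embed : ∀ u u' → Sq G (embed u) (embed u') → Sq G₁ u u'
  square-embed u u' sq@(e≢e' , _) with square-kept (embed-kept u) (embed-kept u') sq
  ... | inj₁ a = e≢e' ∘ cong embed , inj₁ (adj₁-intro a)
  ... | inj₂ (z , Rz , a , a') with embed-onto-kept Rz
  ...   | w , refl = e≢e' ∘ cong embed , inj₂ (w , adj₁-intro a , adj₁-intro a')

  φ : V → Maybe (Fin (n G₁))
  φ x = index (anchor x)

  φ-anchored : ∀ {x h} → anchor x ≡ embed h → φ x ≡ just h
  φ-anchored {h = h} e = trans (cong index e) (index-embed h)

  φ-embed : ∀ h → φ (embed h) ≡ just h
  φ-embed h = φ-anchored (anchor-kept (embed-kept h))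

  branch-elim : ∀ {h x} → branch G G₁ φ h x ≡ true → φ x ≡ just h
  branch-elim {h} {x} b with φ x
  ... | just h' with h ≟ h'
  ...   | yes refl = refl
  branch-elim () | nothing

  branch-intro : ∀ {h x} → φ x ≡ just h → branch G G₁ φ h x ≡ true
  branch-intro {h} {x} e with φ x
  branch-intro {h} refl | just _ with h ≟ h
  ... | yes _ = refl
  ... | no h≢h = contradiction refl h≢h

  G₁-minor : IsMinor G₁ G
  G₁-minor = φ , (λ h → embed h , φ-embed h) , branch-connected , edge
    where
    branch-connected : ∀ h → ConnectedIn G (branch G G₁ φ h)
    branch-connected h = star-connected (embed h) (branch-intro (φ-embed h)) star
      where
      star : ∀ x → branch G G₁ φ h x ≡ true → x ≡ embed h ⊎ adj G x (embed h) ≡ true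
      star x b rewrite embed-index (branch-elim b) = anchor-near x
    edge : ∀ h h' → adj G₁ h h' ≡ true →
           ∃ λ x → ∃ λ y → φ x ≡ just h × φ y ≡ just h' × adj G x y ≡ true
    edge h h' hh' with adj₁-elim hh'
    ... | _ , inj₁ (v , av , v~h') = v , embed h' , φ-anchored av , φ-embed h' , v~h'
    ... | _ , inj₂ (v , av , v~h)  = embed h , v , φ-embed h , φ-anchored av , trans (symm G (embed h) v) v~h

  -- Charged a v y: the G₁-edge a y is charged to the G-neighbour v of a.
  Charged : V → V → V → Set
  Charged a v y = a ≢ y × R y ≡ false × (anchor v ≡ y ⊎ anchor v ≡ a × adj G v y ≡ true)

  charged? : ∀ a v y → Dec (Charged a v y)
  charged? a v y =
    ¬? (a ≟ y) ×-dec (R y Bool.≟ false) ×-dec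
    ((anchor v ≟ y) ⊎-dec ((anchor v ≟ a) ×-dec (adj G v y Bool.≟ true)))

  charges : V → V → ℕ
  charges a v = count (λ y → does (charged? a v y))

  Adj₁-charged : ∀ {a y} → R y ≡ false → Adj₁ a y → ∃ λ v → adj G a v ≡ true × Charged a v y
  Adj₁-charged {a} {y} Ry (a≢y , inj₁ (v , av , v~y)) with anchor-near v
  ... | inj₁ v≡av = y , subst (λ c → adj G c y ≡ true) (trans v≡av av) v~y , a≢y , Ry , inj₁ (anchor-kept Ry)
  ... | inj₂ v~a  = v , trans (symm G a v) (subst (λ c → adj G v c ≡ true) av v~a) , a≢y , Ry , inj₂ (av , v~y)
  Adj₁-charged {a} Ry (a≢y , inj₂ (v , av , v~a)) = v , trans (symm G a v) v~a , a≢y , Ry , inj₁ av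

  deg₁≤charges : ∀ u → deg G₁ u ≤ sumOver (adj G (embed u)) (charges (embed u))
  deg₁≤charges u = begin
    deg G₁ u                                                 ≡⟨ Enumeration.sumF-embed enumKept _ ⟩
    sumOver kept (λ y → if does (adj₁? a y) then 1 else 0)  ≡⟨ sumOver-indicator kept _ ⟩
    count (λ y → kept y ∧ does (adj₁? a y))                  ≤⟨ count-cover (adj G a) _ _ cover ⟩
    sumOver (adj G a) (charges a)                            ∎
    where
    open ≤-Reasoning
    a = embed u
    cover : ∀ y → (kept y ∧ does (adj₁? a y)) ≡ true → ∃ λ v → adj G a v ≡ true × does (charged? a v y) ≡ true
    cover y ka with Adj₁-charged (not-injective (∧-conicalˡ (kept y) _ ka))
                                 (dec-true⁻¹ (adj₁? a y) (∧-conicalʳ (kept y) _ ka))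
    ... | v , av , c = v , av , dec-true (charged? a v y) c

  anchored-removed : ∀ {a v} → adj G a v ≡ true → anchor v ≡ a → R v ≡ true
  anchored-removed {a} {v} av e with R v in Rv
  ... | true  = refl
  ... | false = contradiction e (adj⇒≢ G av ∘ sym)  -- the with turns e into v ≡ a

  charged-anchored : ∀ {a v y} → anchor v ≡ a → Charged a v y → KeptNeighbour v y
  charged-anchored e (a≢y , Ry , inj₁ e')       = contradiction (trans (sym e) e') a≢y
  charged-anchored e (a≢y , Ry , inj₂ (_ , vy)) = vy , Ry

  charges-≤1-unanchored : ∀ {a v} → anchor v ≢ a → charges a v ≤ 1
  charges-≤1-unanchored {a} {v} v↛a = count-≤1 _ (λ y y' c c' → trans (sym (anchored y c)) (anchored y' c'))
    where
    anchored : ∀ y → does (charged? a v y) ≡ true → anchor v ≡ y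
    anchored y c with dec-true⁻¹ (charged? a v y) c
    ... | _ , _ , inj₁ e       = e
    ... | _ , _ , inj₂ (e , _) = contradiction e v↛a

  chargeBound : V → ℕ
  chargeBound v = if R v then deg G v else 1

  charges-≤-chargeBound : ∀ {a v} → adj G a v ≡ true → charges a v ≤ chargeBound v
  charges-≤-chargeBound {a} {v} av = byAnchor (anchor v ≟ a)
    where
    byAnchor : Dec (anchor v ≡ a) → charges a v ≤ chargeBound v
    byAnchor (yes e) = ≤-trans (count-mono (λ y c → proj₁ (charged-anchored e (dec-true⁻¹ (charged? a v y) c))))
                               (≤-reflexive (cong (λ b → if b then deg G v else 1) (sym (anchored-removed av e))))
    byAnchor (no v↛a) = ≤-trans (charges-≤1-unanchored v↛a) 1≤chargeBound
      where
      1≤chargeBound : 1 ≤ chargeBound v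
      1≤chargeBound with R v
      ... | true  = count-pos a (trans (symm G v a) av)
      ... | false = s≤s z≤n

  charges-≤1-at-big : (∀ v → R v ≡ true → Removable Δ G v) →
                      ∀ {a v} → Big a → adj G a v ≡ true → charges a v ≤ 1
  charges-≤1-at-big removable {a} {v} big av = byAnchor (anchor v ≟ a)
    where
    byAnchor : Dec (anchor v ≡ a) → charges a v ≤ 1
    byAnchor (no v↛a) = charges-≤1-unanchored v↛a
    byAnchor (yes e)  = ≤-pred (begin
      suc (charges a v)                               ≤⟨ count-strict a charged⇒bigNeighbour a-bigNeighbour a-uncharged ⟩
      count (λ y → adj G v y ∧ (Δ ≤ᵇ deg G y ^ 4))    ≤⟨ proj₂ (removable v Rv) ⟩
      2                                               ∎)
      where
      open ≤-Reasoning
      Rv = anchored-removed av e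
      bigNeighbour : ∀ {y} → adj G v y ≡ true → Big y → (adj G v y ∧ (Δ ≤ᵇ deg G y ^ 4)) ≡ true
      bigNeighbour vy big-y = cong₂ _∧_ vy (Equivalence.to T-≡ (≤⇒≤ᵇ big-y))
      charged⇒bigNeighbour : ∀ y → does (charged? a v y) ≡ true → (adj G v y ∧ (Δ ≤ᵇ deg G y ^ 4)) ≡ true
      charged⇒bigNeighbour y c = bigNeighbour (proj₁ kn) (anchor-prefers-small Rv kn (subst Big (sym e) big))
        where kn = charged-anchored e (dec-true⁻¹ (charged? a v y) c)
      a-bigNeighbour : (adj G v a ∧ (Δ ≤ᵇ deg G a ^ 4)) ≡ true
      a-bigNeighbour = bigNeighbour (trans (symm G v a) av) big
      a-uncharged : does (charged? a v a) ≡ false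
      a-uncharged = dec-false (charged? a v a) (λ (a≢a , _) → a≢a refl)

  G₁-maxDeg : 0 < Δ → MaxDegLE G Δ → (∀ v → R v ≡ true → Removable Δ G v) → MaxDegLE G₁ Δ
  G₁-maxDeg Δ>0 maxDeg removable u with Δ ≤? deg G (embed u) ^ 4
  ... | yes big = begin
    deg G₁ u                         ≤⟨ deg₁≤charges u ⟩
    sumOver (adj G a) (charges a)    ≤⟨ sumOver-mono (adj G a) (λ v av → charges-≤1-at-big removable big av) ⟩
    deg G a                          ≤⟨ maxDeg a ⟩
    Δ                                ∎
    where open ≤-Reasoning; a = embed u
  ... | no small = begin
    deg G₁ u                         ≤⟨ deg₁≤charges u ⟩
    sumOver (adj G a) (charges a)    ≤⟨ sumOver-mono (adj G a) (λ v av → charges-≤-chargeBound av) ⟩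
    sumOver (adj G a) chargeBound    ≤⟨ sumOver-≤-fourthRoots Δ (adj G a) chargeBound (<⇒≤ (≰⇒> small)) bound⁴≤Δ ⟩
    Δ                                ∎
    where
    open ≤-Reasoning
    a = embed u
    bound⁴≤Δ : ∀ v → chargeBound v ^ 4 ≤ Δ
    bound⁴≤Δ v with R v in Rv
    ... | true  = proj₁ (removable v Rv)
    ... | false = Δ>0

lemma3p1 : (F : Family) → Nice F → (Δ : ℕ) → 0 < Δ →
    (G : Graph) → F G → MaxDegLE G Δ →
    (R : VSet G) → (∀ v → R v ≡ true → Removable Δ G v) →
    Σ Graph λ G₁ → F G₁ × MaxDegLE G₁ Δ ×
      Σ (Fin (n G₁) → Fin (n G)) λ ι →
        Injective _≡_ _≡_ ι ×
        (∀ u → R (ι u) ≡ false) ×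
        (∀ v → R v ≡ false → ∃ λ u → ι u ≡ v) ×
        (∀ u u' → Sq G (ι u) (ι u') → Sq G₁ u u')
lemma3p1 F (minorClosed , _) Δ Δ>0 G FG maxDeg R removable =
  G₁ , minorClosed G G₁ FG G₁-minor , G₁-maxDeg Δ>0 maxDeg removable ,
  embed , embed-injective , embed-kept , (λ v → embed-onto-kept) , square-embed
  where open Contraction Δ G R
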